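{- For every graph $G$ and every $X\subseteq V(G)$, $\mathrm{nd}(G[X])\le\mathrm{nd}(G)$.
   Context: The neighbor-depth $\mathrm{nd}(G)$ is defined recursively: $\mathrm{nd}(G)=0$ iff $V(G)=\emptyset$; if $G$ is disconnected, $\mathrm{nd}(G)$ is the maximum of $\mathrm{nd}$ over its connected components; if $G$ is non-empty and connected, $\mathrm{nd}(G)\le k$ iff there is $v\in V(G)$ with $\mathrm{nd}(G\setminus N[v])\le k-1$ and $\mathrm{nd}(G\setminus\{v\})\le k$ ($N[v]$ the closed neighborhood, $G\setminus X=G[V(G)\setminus X]$). -}

module Defs where

open import Data.Nat using (ℕ; zero; suc)
open import Data.Fin using (Fin)
open import Data.Product using (Σ; _×_; ∃)
open import Data.Empty using (⊥)
open import Data.Unit using (⊤)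
open import Relation.Nullary using (¬_; Dec)
open import Relation.Binary.PropositionalEquality using (_≡_)

record Graph : Set₁ where
  field
    n      : ℕ
    Adj    : Fin n → Fin n → Set
    adj?   : ∀ u v → Dec (Adj u v)
    sym    : ∀ {u v} → Adj u v → Adj v u
    irrefl : ∀ {u} → ¬ Adj u u

module _ (G : Graph) where
  open Graph G

  -- Vertex subsets (induced subgraphs G[S] are represented by S).
  VSet : Set₁
  VSet = Fin n → Set

  -- Reachability from u to w by a path inside G[S] (u assumed in S).
  data Reach (S : VSet) (u : Fin n) : Fin n → Set where
    here : Reach S u u
    step : ∀ {v w} → Reach S u v → Adj v w → S w → Reach S u w

  Connected : VSet → Set
  Connected S = (∃ λ u → S u) × (∀ u w → S u → S w → Reach S u w)

  Comp : VSet → Fin n → VSet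
  Comp S u w = S w × Reach S u w

  minusV : VSet → Fin n → VSet
  minusV S v w = S w × ¬ (w ≡ v)

  minusN : VSet → Fin n → VSet
  minusN S v w = S w × ¬ (w ≡ v) × ¬ Adj v w

  -- NdLe S k  means  nd(G[S]) ≤ k, following the recursive definition:
  --  * empty graph: nd = 0 ≤ k;
  --  * disconnected: nd is the max over components;
  --  * non-empty connected: nd ≤ k iff some v with nd(G∖N[v]) ≤ k-1
  --    and nd(G∖v) ≤ k (this forces k ≥ 1).
  data NdLe : VSet → ℕ → Set₁ where
    nd-empty : ∀ {S k} → (∀ w → ¬ S w) → NdLe S k
    nd-disc  : ∀ {S k} → (∃ λ u → S u) → ¬ Connected S →
               (∀ u → S u → NdLe (Comp S u) k) → NdLe S k
    nd-conn  : ∀ {S k} → Connected S → (v : Fin n) → S v →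
               NdLe (minusN S v) k → NdLe (minusV S v) (suc k) →
               NdLe S (suc k)

  Full : VSet
  Full _ = ⊤

-- Induct on the derivation of nd(G[S]) ≤ k, carrying an arbitrary decidable T ⊆ S.
-- If the derivation removes v and then N[v], a connected G[T] containing v
-- removes the same vertices; if v ∉ T, then T already lies in S ∖ {v}.  If G[S]
-- is disconnected, a connected G[T] lies inside one component.  To rebuild a
-- derivation for T we must know whether G[T] is empty, connected or
-- disconnected, so reachability inside a decidable vertex set is decided first.
module Submission where

open import Defs
open import Data.Nat using (ℕ; zero; suc; _≤_)
open import Data.Nat.Properties using (≤-pred; <-≤-trans; ≤-refl)
open import Data.Fin using (Fin; _≟_)
open import Data.Fin.Properties using (any?; all?)
open import Data.Fin.Subset using (Subset; _∈_)
open import Data.Fin.Subset.Properties using (_∈?_)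
open import Data.List using (List; []; _∷_; length; filter; allFin)
open import Data.List.Properties using (filter-notAll)
import Data.List.Membership.Propositional as List
open import Data.List.Membership.Propositional.Properties using (∈-filter⁺; ∈-allFin)
import Data.List.Relation.Unary.Any as Any
open import Data.Product using (_×_; ∃; _,_; proj₁; proj₂; map₁)
open import Data.Sum using (_⊎_; inj₁; inj₂; [_,_]′)
open import Data.Empty using (⊥-elim)
open import Data.Unit using (tt)
open import Function using (_∘_; id)
open import Relation.Nullary using (Dec; yes; no; ¬?)
open import Relation.Nullary.Decidable using (_×-dec_; _→-dec_; map′)
open import Relation.Unary using (Decidable; _⊆_)
open import Relation.Binary.PropositionalEquality using (_≡_; refl; sym)

module NeighbourDepth (G : Graph) where
  open Graph G using (n; Adj; adj?; irrefl) renaming (sym to Adj-sym)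

  private
    variable
      S T : VSet G
      u v w : Fin n
      k : ℕ

  reach-mono : S ⊆ T → Reach G S u w → Reach G T u w
  reach-mono S⊆T here          = here
  reach-mono S⊆T (step p e Sw) = step (reach-mono S⊆T p) e (S⊆T Sw)

  reach-target : S u → Reach G S u w → S w
  reach-target Su here          = Su
  reach-target Su (step _ _ Sw) = Sw

  reach-trans : Reach G S u v → Reach G S v w → Reach G S u w
  reach-trans p here          = p
  reach-trans p (step q e Sw) = step (reach-trans p q) e Sw

  reach-cons : Adj u v → S v → Reach G S v w → Reach G S u w
  reach-cons e Sv here           = step here e Sv
  reach-cons e Sv (step p e′ Sw) = step (reach-cons e Sv p) e′ Sw

  reach-sym : S u → Reach G S u w → Reach G S w u
  reach-sym Su here          = here
  reach-sym Su (step p e Sw) = reach-cons (Adj-sym e) (reach-target Su p) (reach-sym Su p)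

  reach-in-component : Reach G S u v → Reach G S v w → Reach G (Comp G S u) v w
  reach-in-component p here          = here
  reach-in-component p (step q e Sw) =
    step (reach-in-component p q) e (Sw , step (reach-trans p q) e Sw)

  component-connected : S u → Connected G (Comp G S u)
  component-connected Su =
    (_ , Su , here) ,
    λ { _ _ (_ , p) (_ , q) → reach-in-component p (reach-trans (reach-sym Su p) q) }

  FirstStep : VSet G → Fin n → Fin n → Set
  FirstStep S u w = ∃ λ v → Adj u v × S v × Reach G (minusV G S u) v w

  reach-split : Reach G S u w → u ≡ w ⊎ FirstStep S u w
  reach-split here = inj₁ refl
  reach-split {u = u} (step {w = w} p e Sw) with w ≟ u | reach-split p
  ... | yes w≡u | _                      = inj₁ (sym w≡u)
  ... | no w≢u  | inj₁ refl              = inj₂ (w , e , Sw , here)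
  ... | no w≢u  | inj₂ (v , e′ , Sv , q) = inj₂ (v , e′ , Sv , step q e (Sw , w≢u))

  reach-unsplit : FirstStep S u w → Reach G S u w
  reach-unsplit (v , e , Sv , q) = reach-cons e Sv (reach-mono proj₁ q)

  minusV? : Decidable S → ∀ v → Decidable (minusV G S v)
  minusV? S? v w = S? w ×-dec ¬? (w ≟ v)

  minusN? : Decidable S → ∀ v → Decidable (minusN G S v)
  minusN? S? v w = S? w ×-dec ¬? (w ≟ v) ×-dec ¬? (adj? v w)

  -- The fuel m bounds the length of a list L covering S; the recursive call
  -- works in S ∖ {u}, covered by L without u.
  reach?-bounded : ∀ m (L : List (Fin n)) → length L ≤ m →
                   Decidable S → (∀ {x} → S x → x List.∈ L) →
                   S u → ∀ w → Dec (Reach G S u w)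
  reach?-bounded zero [] _ _ S⊆L Su _ with () ← S⊆L Su
  reach?-bounded {S = S} {u = u} (suc m) L |L|≤1+m S? S⊆L Su w with u ≟ w
  ... | yes refl = yes here
  ... | no u≢w   = map′ reach-unsplit (λ r → [ ⊥-elim ∘ u≢w , id ]′ (reach-split r))
                        (any? first-step?)
    where
    L∖u : List (Fin n)
    L∖u = filter (λ x → ¬? (x ≟ u)) L

    |L∖u|≤m : length L∖u ≤ m
    |L∖u|≤m = ≤-pred (<-≤-trans (filter-notAll (λ x → ¬? (x ≟ u)) L
                                   (Any.map (λ { refl x≢u → x≢u refl }) (S⊆L Su)))
                                 |L|≤1+m)

    first-step? : ∀ v → Dec (Adj u v × S v × Reach G (minusV G S u) v w)
    first-step? v with adj? u v | S? v
    ... | no ¬e | _     = no (¬e ∘ proj₁)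
    ... | yes _ | no ¬Sv = no (¬Sv ∘ proj₁ ∘ proj₂)
    ... | yes e | yes Sv =
      map′ (λ q → e , Sv , q) (proj₂ ∘ proj₂)
           (reach?-bounded m L∖u |L∖u|≤m (minusV? S? u)
              (λ { (Sx , x≢u) → ∈-filter⁺ (λ x → ¬? (x ≟ u)) (S⊆L Sx) x≢u })
              (Sv , λ { refl → irrefl e }) w)

  reach? : Decidable S → S u → ∀ w → Dec (Reach G S u w)
  reach? S? = reach?-bounded _ (allFin n) ≤-refl S? (λ {x} _ → ∈-allFin x)

  component? : Decidable S → S u → Decidable (Comp G S u)
  component? S? Su w = S? w ×-dec reach? S? Su w

  connected? : Decidable S → Dec (Connected G S)
  connected? {S = S} S? = any? S? ×-dec all? (λ u → all? (connected-pair? u))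
    where
    connected-pair? : ∀ u w → Dec (S u → S w → Reach G S u w)
    connected-pair? u w with S? u
    ... | yes Su = map′ (λ r _ → r) (λ f → f Su) (S? w →-dec reach? S? Su w)
    ... | no ¬Su = yes (⊥-elim ∘ ¬Su)

  mutual
    ndLe-mono : NdLe G S k → Decidable T → T ⊆ S → NdLe G T k
    ndLe-mono d T? T⊆S with any? T? | connected? T?
    ... | no ∄T  | _         = nd-empty (λ w Tw → ∄T (w , Tw))
    ... | yes ∃T | yes T-con = ndLe-mono-connected d T? T-con T⊆S
    ... | yes ∃T | no ¬T-con = nd-disc ∃T ¬T-con λ u Tu →
      ndLe-mono-connected d (component? T? Tu) (component-connected Tu) (T⊆S ∘ proj₁)

    ndLe-mono-connected : NdLe G S k → Decidable T → Connected G T → T ⊆ S → NdLe G T k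
    ndLe-mono-connected (nd-empty ∄S) _ ((u , Tu) , _) T⊆S = ⊥-elim (∄S u (T⊆S Tu))
    ndLe-mono-connected (nd-disc _ _ d-comp) T? ((u , Tu) , T-con) T⊆S =
      ndLe-mono (d-comp u (T⊆S Tu)) T? (λ {w} Tw → T⊆S Tw , reach-mono T⊆S (T-con u w Tu Tw))
    ndLe-mono-connected (nd-conn _ v _ d-minusN d-minusV) T? T-con T⊆S with T? v
    ... | yes Tv = nd-conn T-con v Tv (ndLe-mono d-minusN (minusN? T? v) (map₁ T⊆S))
                                      (ndLe-mono d-minusV (minusV? T? v) (map₁ T⊆S))
    ... | no ¬Tv = ndLe-mono d-minusV T? (λ Tw → T⊆S Tw , λ { refl → ¬Tv Tw })

open NeighbourDepth using (ndLe-mono)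

lemma10 : (G : Graph) (X : Subset (Graph.n G)) (k : ℕ) →
          NdLe G (Full G) k → NdLe G (λ v → v ∈ X) k
lemma10 G X k nd-G≤k = ndLe-mono G nd-G≤k (_∈? X) (λ _ → tt)
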